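{- There are no integers, and no rational numbers, $x_1,x_2,x_3,d_1,d_2,d_3,L$ with $\operatorname{rank}N_1=2$ and $\operatorname{rank}N_2=1$ that satisfy the eight factor equations $\tilde p_1=\tilde p_2=\tilde p_3=\tilde p_4=\tilde p_5=\tilde p_6=\tilde p_7=\tilde p_8=0$; likewise there are none with $\operatorname{rank}N_1=2$ and $\operatorname{rank}N_2=1$ satisfying the equations $p_0=p_1=p_2=p_3=0$.
   Context: Define $p_0=x_1^2+x_2^2+x_3^2-L^2$, $p_1=x_2^2+x_3^2-d_1^2$, $p_2=x_3^2+x_1^2-d_2^2$, $p_3=x_1^2+x_2^2-d_3^2$, and $\tilde p_1=p_0$, $\tilde p_2=p_1+p_2+p_3$, $\tilde p_3=\sum_i d_ip_i$, $\tilde p_4=\sum_i x_ip_i$, $\tilde p_5=\sum_i x_id_ip_i$, $\tilde p_6=\sum_i x_i^2p_i$, $\tilde p_7=\sum_i d_i^2p_i$, $\tilde p_8=\sum_i x_i^2d_i^2p_i$ (sums over $i=1,2,3$). $N_1$ is the $3\times2$ matrix with rows $(1,d_i)$, $i=1,2,3$, and $N_2$ is the $3\times 2$ matrix with rows $(1,x_i)$, $i=1,2,3$. -}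

module Defs where

open import Data.Nat using (ℕ)
open import Data.Fin using (Fin; zero; suc)
open import Data.Product using (Σ; ∃; _×_)
open import Relation.Binary.PropositionalEquality using (_≡_; _≢_)
open import Relation.Nullary using (¬_)
open import Data.Empty using (⊥)
import Data.Integer as ℤ
import Data.Rational as ℚ

module Generic {A : Set} (0# : A) (1# : A) (plus times : A → A → A) (neg : A → A) where

  infixl 6 _+_ _-_
  infixl 7 _*_
  infix 8 -_

  _+_ _*_ : A → A → A
  _+_ = plus
  _*_ = times

  -_ : A → A
  -_ = neg

  _-_ : A → A → A
  a - b = a + (- b)

  sq : A → A
  sq a = a * a

  -- sum over i = 1,2,3 (indices 0,1,2 of Fin 3)
  Σ₃ : (Fin 3 → A) → A
  Σ₃ f = f zero + f (suc zero) + f (suc (suc zero))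

  p₀ : (Fin 3 → A) → A → A
  p₀ x L = sq (x zero) + sq (x (suc zero)) + sq (x (suc (suc zero))) - sq L

  p : (Fin 3 → A) → (Fin 3 → A) → Fin 3 → A
  p x d zero                = sq (x (suc zero)) + sq (x (suc (suc zero))) - sq (d zero)
  p x d (suc zero)          = sq (x (suc (suc zero))) + sq (x zero) - sq (d (suc zero))
  p x d (suc (suc zero))    = sq (x zero) + sq (x (suc zero)) - sq (d (suc (suc zero)))

  p̃₁ p̃₂ p̃₃ p̃₄ p̃₅ p̃₆ p̃₇ p̃₈ : (Fin 3 → A) → (Fin 3 → A) → A → A
  p̃₁ x d L = p₀ x L
  p̃₂ x d L = Σ₃ (λ i → p x d i)
  p̃₃ x d L = Σ₃ (λ i → d i * p x d i)
  p̃₄ x d L = Σ₃ (λ i → x i * p x d i)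
  p̃₅ x d L = Σ₃ (λ i → x i * d i * p x d i)
  p̃₆ x d L = Σ₃ (λ i → sq (x i) * p x d i)
  p̃₇ x d L = Σ₃ (λ i → sq (d i) * p x d i)
  p̃₈ x d L = Σ₃ (λ i → sq (x i) * sq (d i) * p x d i)

  Mat : Set
  Mat = Fin 3 → Fin 2 → A

  minor : Mat → Fin 3 → Fin 3 → A
  minor M i j = M i zero * M j (suc zero) - M j zero * M i (suc zero)

  -- Determinantal rank of a 3×2 matrix: largest size of a non-vanishing minor.
  Rank : Mat → ℕ → Set
  Rank M 0 = ∀ i k → M i k ≡ 0#
  Rank M 1 = (∃ λ i → ∃ λ k → M i k ≢ 0#) × (∀ i j → minor M i j ≡ 0#)
  Rank M 2 = ∃ λ i → ∃ λ j → minor M i j ≢ 0#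
  Rank M _ = ⊥  -- a 3×2 matrix has rank ≤ 2

  N : (Fin 3 → A) → Mat
  N v i zero       = 1#
  N v i (suc zero) = v i

  N₁ N₂ : (Fin 3 → A) → Mat
  N₁ d = N d
  N₂ x = N x

  EightEqs : (Fin 3 → A) → (Fin 3 → A) → A → Set
  EightEqs x d L =
    (p̃₁ x d L ≡ 0#) × (p̃₂ x d L ≡ 0#) × (p̃₃ x d L ≡ 0#) × (p̃₄ x d L ≡ 0#) ×
    (p̃₅ x d L ≡ 0#) × (p̃₆ x d L ≡ 0#) × (p̃₇ x d L ≡ 0#) × (p̃₈ x d L ≡ 0#)

  FourEqs : (Fin 3 → A) → (Fin 3 → A) → A → Set
  FourEqs x d L =
    (p₀ x L ≡ 0#) × (p x d zero ≡ 0#) × (p x d (suc zero) ≡ 0#) × (p x d (suc (suc zero)) ≡ 0#)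

  NoEight : Set
  NoEight = ∀ (x d : Fin 3 → A) (L : A) → Rank (N₁ d) 2 → Rank (N₂ x) 1 → ¬ EightEqs x d L

  NoFour : Set
  NoFour = ∀ (x d : Fin 3 → A) (L : A) → Rank (N₁ d) 2 → Rank (N₂ x) 1 → ¬ FourEqs x d L

module Zs = Generic (ℤ.+ 0) (ℤ.+ 1) ℤ._+_ ℤ._*_ ℤ.-_
module Qs = Generic ℚ.0ℚ ℚ.1ℚ ℚ._+_ ℚ._*_ ℚ.-_

-- Rank N₂ = 1 forces x₁ = x₂ = x₃ = a, so p₀ = 0 reads L² = 3a², and a = 0 because √3 is
-- irrational (infinite descent on 3 ∣ x² in ℕ, carried to ℤ by absolute values and to ℚ by
-- clearing denominators). At x = 0 every pᵢ equals −dᵢ², so p₁ + p₂ + p₃ = 0 (this is p̃₂,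
-- and it follows from the four equations) forces d = 0 because ℤ and ℚ are ordered. Then all
-- minors of N₁ vanish, contradicting rank N₁ = 2.
module Submission where

open import Defs
open import Data.Product using (_×_; _,_; proj₁; proj₂)
open import Data.Fin using (zero; suc)
open import Data.Empty using (⊥; ⊥-elim)
open import Relation.Nullary using (¬_)
open import Relation.Binary.PropositionalEquality
open import Level using (0ℓ)
open import Algebra.Bundles using (AbelianGroup)
open import Algebra.Structures using (IsCommutativeRing)
open import Relation.Binary.Bundles using (Poset)
open import Relation.Binary.Structures using (IsPartialOrder)
import Relation.Binary.Reasoning.PartialOrder as PosetReasoning
import Algebra.Properties.AbelianGroup as AbelianGroupProperties
open import Data.Sum using ([_,_]′)
open import Function using (id)
open import Data.Unit using (tt)
import Data.Nat as ℕ
import Data.Nat.Properties as ℕP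
open import Data.Nat.Divisibility using (_∣_; divides)
open import Data.Nat.Primality using (prime?; euclidsLemma)
open import Data.Nat.Induction using (<-rec)
open import Data.Nat.Tactic.RingSolver using (solve-∀)
open import Relation.Nullary.Decidable using (toWitness)
import Data.Integer as ℤ
import Data.Integer.Properties as ℤP
import Data.Integer.Tactic.RingSolver as ℤ-Solver
import Data.Rational as ℚ
import Data.Rational.Properties as ℚP
import Data.Rational.Unnormalised as ℚᵘ
import Data.Rational.Unnormalised.Properties as ℚᵘP

module CommutativeRingArgument
  {A : Set} {0# 1# : A} {plus times : A → A → A} {neg : A → A}
  (isCommutativeRing : IsCommutativeRing _≡_ plus times neg 0# 1#)
  where

  open Generic 0# 1# plus times neg
  open IsCommutativeRing isCommutativeRing
    using (+-isAbelianGroup; +-identityˡ; -‿inverseʳ; *-identityˡ; zeroˡ; distribʳ)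
  +-abelianGroup : AbelianGroup 0ℓ 0ℓ
  +-abelianGroup = record { isAbelianGroup = +-isAbelianGroup }

  open AbelianGroupProperties +-abelianGroup
    using (x∙y⁻¹≈ε⇒x≈y; ⁻¹-∙-comm; ⁻¹-involutive; ε⁻¹≈ε)
  open ≡-Reasoning

  x-y≡0⇒x≡y : ∀ {x y} → x - y ≡ 0# → x ≡ y
  x-y≡0⇒x≡y = x∙y⁻¹≈ε⇒x≈y _ _

  -x≡0⇒x≡0 : ∀ {x} → - x ≡ 0# → x ≡ 0#
  -x≡0⇒x≡0 {x} -x≡0 = begin
    x      ≡⟨ ⁻¹-involutive x ⟨
    - - x  ≡⟨ cong -_ -x≡0 ⟩
    - 0#   ≡⟨ ε⁻¹≈ε ⟩
    0#     ∎

  -x+-y+-z≡-[x+y+z] : ∀ x y z → - x + - y + - z ≡ - (x + y + z)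
  -x+-y+-z≡-[x+y+z] x y z = begin
    - x + - y + - z    ≡⟨ cong (_+ - z) (⁻¹-∙-comm x y) ⟩
    - (x + y) + - z    ≡⟨ ⁻¹-∙-comm (x + y) z ⟩
    - (x + y + z)      ∎

  x+x+x≡3*x : ∀ x → x + x + x ≡ (1# + 1# + 1#) * x
  x+x+x≡3*x x = sym (begin
    (1# + 1# + 1#) * x            ≡⟨ distribʳ x (1# + 1#) 1# ⟩
    (1# + 1#) * x + 1# * x        ≡⟨ cong (_+ 1# * x) (distribʳ x 1# 1#) ⟩
    1# * x + 1# * x + 1# * x      ≡⟨ cong₂ _+_ (cong₂ _+_ (*-identityˡ x) (*-identityˡ x)) (*-identityˡ x) ⟩
    x + x + x                     ∎)

  0+0+0≡0 : 0# + 0# + 0# ≡ 0#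
  0+0+0≡0 = trans (cong (_+ 0#) (+-identityˡ 0#)) (+-identityˡ 0#)

  minor-N : ∀ v i j → minor (N v) i j ≡ v j - v i
  minor-N v i j = cong₂ _-_ (*-identityˡ (v j)) (*-identityˡ (v i))

  rank₁⇒constant : ∀ {v} → Rank (N v) 1 → ∀ i → v i ≡ v zero
  rank₁⇒constant {v} (_ , minors≡0) i =
    sym (x-y≡0⇒x≡y (trans (sym (minor-N v i zero)) (minors≡0 i zero)))

  rank₂⇒nonconstant : ∀ {v c} → Rank (N v) 2 → ¬ (∀ i → v i ≡ c)
  rank₂⇒nonconstant {v} {c} (i , j , minor≢0) v≡c = minor≢0 (begin
    minor (N v) i j  ≡⟨ minor-N v i j ⟩
    v j - v i        ≡⟨ cong₂ _-_ (v≡c j) (v≡c i) ⟩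
    c - c            ≡⟨ -‿inverseʳ c ⟩
    0#               ∎)

  p₀-constant : ∀ {x a} L → (∀ i → x i ≡ a) → p₀ x L ≡ (1# + 1# + 1#) * sq a - sq L
  p₀-constant {x} {a} L x≡a = cong (_- sq L) (begin
    sq (x zero) + sq (x (suc zero)) + sq (x (suc (suc zero)))
      ≡⟨ cong₂ _+_ (cong₂ _+_ (cong sq (x≡a zero)) (cong sq (x≡a (suc zero))))
                   (cong sq (x≡a (suc (suc zero)))) ⟩
    sq a + sq a + sq a
      ≡⟨ x+x+x≡3*x (sq a) ⟩
    (1# + 1# + 1#) * sq a ∎)

  0²+0²-c≡-c : ∀ c → sq 0# + sq 0# - c ≡ - c
  0²+0²-c≡-c c = begin
    sq 0# + sq 0# - c  ≡⟨ cong (λ t → t + t - c) (zeroˡ 0#) ⟩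
    0# + 0# - c        ≡⟨ cong (_- c) (+-identityˡ 0#) ⟩
    0# - c             ≡⟨ +-identityˡ (- c) ⟩
    - c                ∎

  p-at-origin : ∀ {x} d → (∀ i → x i ≡ 0#) → ∀ i → p x d i ≡ - sq (d i)
  p-at-origin d x≡0 zero
    rewrite x≡0 (suc zero) | x≡0 (suc (suc zero)) = 0²+0²-c≡-c _
  p-at-origin d x≡0 (suc zero)
    rewrite x≡0 (suc (suc zero)) | x≡0 zero = 0²+0²-c≡-c _
  p-at-origin d x≡0 (suc (suc zero))
    rewrite x≡0 zero | x≡0 (suc zero) = 0²+0²-c≡-c _

  p̃₂-at-origin : ∀ {x} d L → (∀ i → x i ≡ 0#) →
                 p̃₂ x d L ≡ - (sq (d zero) + sq (d (suc zero)) + sq (d (suc (suc zero))))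
  p̃₂-at-origin d L x≡0 = trans
    (cong₂ _+_ (cong₂ _+_ (p-at-origin d x≡0 zero) (p-at-origin d x≡0 (suc zero)))
               (p-at-origin d x≡0 (suc (suc zero))))
    (-x+-y+-z≡-[x+y+z] _ _ _)

  module Nonexistence
    (x²≡3y²⇒y≡0 : ∀ x y → x * x ≡ (1# + 1# + 1#) * (y * y) → y ≡ 0#)
    (x²+y²+z²≡0⇒x≡0×y≡0×z≡0 : ∀ x y z → x * x + y * y + z * z ≡ 0# →
                               x ≡ 0# × y ≡ 0# × z ≡ 0#)
    where

    rank₁∧p₀≡0⇒origin : ∀ {x L} → Rank (N x) 1 → p₀ x L ≡ 0# → ∀ i → x i ≡ 0#
    rank₁∧p₀≡0⇒origin {x} {L} rank₁ p₀≡0 i = trans (x≡x₀ i) x₀≡0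
      where
      x≡x₀ : ∀ i → x i ≡ x zero
      x≡x₀ = rank₁⇒constant rank₁
      x₀≡0 : x zero ≡ 0#
      x₀≡0 = x²≡3y²⇒y≡0 L (x zero)
               (sym (x-y≡0⇒x≡y (trans (sym (p₀-constant L x≡x₀)) p₀≡0)))

    p₀∧p̃₂-no-common-root : ∀ {x d L} → Rank (N d) 2 → Rank (N x) 1 →
                           p₀ x L ≡ 0# → p̃₂ x d L ≡ 0# → ⊥
    p₀∧p̃₂-no-common-root {x} {d} {L} rank₂ rank₁ p₀≡0 p̃₂≡0 = rank₂⇒nonconstant rank₂ d≡0
      where
      d₀≡0×d₁≡0×d₂≡0 : d zero ≡ 0# × d (suc zero) ≡ 0# × d (suc (suc zero)) ≡ 0#
      d₀≡0×d₁≡0×d₂≡0 = x²+y²+z²≡0⇒x≡0×y≡0×z≡0 _ _ _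
        (-x≡0⇒x≡0 (trans (sym (p̃₂-at-origin d L (rank₁∧p₀≡0⇒origin rank₁ p₀≡0))) p̃₂≡0))
      d≡0 : ∀ i → d i ≡ 0#
      d≡0 zero             = proj₁ d₀≡0×d₁≡0×d₂≡0
      d≡0 (suc zero)       = proj₁ (proj₂ d₀≡0×d₁≡0×d₂≡0)
      d≡0 (suc (suc zero)) = proj₂ (proj₂ d₀≡0×d₁≡0×d₂≡0)

    noEight : NoEight
    noEight x d L rank₂ rank₁ (p̃₁≡0 , p̃₂≡0 , _) = p₀∧p̃₂-no-common-root rank₂ rank₁ p̃₁≡0 p̃₂≡0

    noFour : NoFour
    noFour x d L rank₂ rank₁ (p₀≡0 , p₁≡0 , p₂≡0 , p₃≡0) =
      p₀∧p̃₂-no-common-root rank₂ rank₁ p₀≡0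
        (trans (cong₂ _+_ (cong₂ _+_ p₁≡0 p₂≡0) p₃≡0) 0+0+0≡0)

module OrderedSquares
  {A : Set} {0# 1# : A} {plus times : A → A → A} {neg : A → A} {leq : A → A → Set}
  (isCommutativeRing : IsCommutativeRing _≡_ plus times neg 0# 1#)
  (≤-isPartialOrder : IsPartialOrder _≡_ leq)
  where

  infix 4 _≤_
  _≤_ : A → A → Set
  _≤_ = leq

  open Generic 0# 1# plus times neg using (_+_; _*_)
  open IsCommutativeRing isCommutativeRing using (+-identityˡ; +-identityʳ)
  open IsPartialOrder ≤-isPartialOrder using () renaming (refl to ≤-refl; antisym to ≤-antisym)
  ≤-poset : Poset 0ℓ 0ℓ 0ℓ
  ≤-poset = record { isPartialOrder = ≤-isPartialOrder }

  open PosetReasoning ≤-poset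

  module _
    (+-mono-≤ : ∀ {a b c d} → a ≤ b → c ≤ d → a + c ≤ b + d)
    (0≤x*x : ∀ x → 0# ≤ x * x)
    (x*x≡0⇒x≡0 : ∀ x → x * x ≡ 0# → x ≡ 0#)
    where

    0≤a∧0≤b∧a+b≡0⇒a≡0×b≡0 : ∀ {a b} → 0# ≤ a → 0# ≤ b → a + b ≡ 0# → a ≡ 0# × b ≡ 0#
    0≤a∧0≤b∧a+b≡0⇒a≡0×b≡0 {a} {b} 0≤a 0≤b a+b≡0 = ≤-antisym a≤0 0≤a , ≤-antisym b≤0 0≤b
      where
      a≤0 : a ≤ 0#
      a≤0 = begin
        a       ≡⟨ +-identityʳ a ⟨
        a + 0#  ≤⟨ +-mono-≤ ≤-refl 0≤b ⟩
        a + b   ≡⟨ a+b≡0 ⟩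
        0#      ∎
      b≤0 : b ≤ 0#
      b≤0 = begin
        b       ≡⟨ +-identityˡ b ⟨
        0# + b  ≤⟨ +-mono-≤ 0≤a ≤-refl ⟩
        a + b   ≡⟨ a+b≡0 ⟩
        0#      ∎

    x²+y²+z²≡0⇒x≡0×y≡0×z≡0 : ∀ x y z → x * x + y * y + z * z ≡ 0# →
                               x ≡ 0# × y ≡ 0# × z ≡ 0#
    x²+y²+z²≡0⇒x≡0×y≡0×z≡0 x y z sum≡0 =
      x*x≡0⇒x≡0 x (proj₁ x²≡0×y²≡0) ,
      x*x≡0⇒x≡0 y (proj₂ x²≡0×y²≡0) ,
      x*x≡0⇒x≡0 z (proj₂ x²+y²≡0×z²≡0)
      where
      0≤x²+y² : 0# ≤ x * x + y * y
      0≤x²+y² = begin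
        0#               ≡⟨ +-identityˡ 0# ⟨
        0# + 0#          ≤⟨ +-mono-≤ (0≤x*x x) (0≤x*x y) ⟩
        x * x + y * y    ∎
      x²+y²≡0×z²≡0 : x * x + y * y ≡ 0# × z * z ≡ 0#
      x²+y²≡0×z²≡0 = 0≤a∧0≤b∧a+b≡0⇒a≡0×b≡0 0≤x²+y² (0≤x*x z) sum≡0
      x²≡0×y²≡0 : x * x ≡ 0# × y * y ≡ 0#
      x²≡0×y²≡0 = 0≤a∧0≤b∧a+b≡0⇒a≡0×b≡0 (0≤x*x x) (0≤x*x y) (proj₁ x²+y²≡0×z²≡0)

module ℕ-Lemmas where
  open ℕ using (zero; suc; _*_; _<_)

  3∣n*n⇒3∣n : ∀ n → 3 ∣ n * n → 3 ∣ n
  3∣n*n⇒3∣n n 3∣n*n = [ id , id ]′ (euclidsLemma n n (toWitness {a? = prime? 3} tt) 3∣n*n)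

  x²≡3y²⇒3∣x : ∀ x y → x * x ≡ 3 * (y * y) → 3 ∣ x
  x²≡3y²⇒3∣x x y x²≡3y² = 3∣n*n⇒3∣n x (divides (y * y) (trans x²≡3y² (ℕP.*-comm 3 (y * y))))

  [3m]²≡3y²⇒y²≡3m² : ∀ m y → m * 3 * (m * 3) ≡ 3 * (y * y) → y * y ≡ 3 * (m * m)
  [3m]²≡3y²⇒y²≡3m² m y [3m]²≡3y² =
    ℕP.*-cancelˡ-≡ (y * y) (3 * (m * m)) 3 (trans (sym [3m]²≡3y²) ([3m]²≡3[3m²] m))
    where
    [3m]²≡3[3m²] : ∀ m → m * 3 * (m * 3) ≡ 3 * (3 * (m * m))
    [3m]²≡3[3m²] = solve-∀

  x²≡3y²⇒y≡0 : ∀ x y → x * x ≡ 3 * (y * y) → y ≡ 0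
  x²≡3y²⇒y≡0 x y = <-rec (λ y → ∀ x → x * x ≡ 3 * (y * y) → y ≡ 0) descend y x
    where
    descend : ∀ y → (∀ {k} → k < y → ∀ x → x * x ≡ 3 * (k * k) → k ≡ 0) →
              ∀ x → x * x ≡ 3 * (y * y) → y ≡ 0
    descend y smaller x x²≡3y² with x²≡3y²⇒3∣x x y x²≡3y²
    ... | divides m refl with x²≡3y²⇒3∣x y m ([3m]²≡3y²⇒y²≡3m² m y x²≡3y²)
    ... | divides zero refl = refl
    ... | divides k@(suc _) refl
      with () ← smaller (ℕP.m<m*n k 3 (ℕ.s≤s (ℕ.s≤s ℕ.z≤n))) m
                  ([3m]²≡3y²⇒y²≡3m² k m ([3m]²≡3y²⇒y²≡3m² m (k * 3) x²≡3y²))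

module ℤ-Lemmas where
  open ℤ using (+_; -[1+_]; 0ℤ; _+_; _*_; _≤_; +≤+; ∣_∣)

  x²≡3y²⇒y≡0 : ∀ x y → x * x ≡ + 3 * (y * y) → y ≡ 0ℤ
  x²≡3y²⇒y≡0 x y x²≡3y² = ℤP.∣i∣≡0⇒i≡0 (ℕ-Lemmas.x²≡3y²⇒y≡0 ∣ x ∣ ∣ y ∣ (begin
    ∣ x ∣ ℕ.* ∣ x ∣              ≡⟨ ℤP.abs-* x x ⟨
    ∣ x * x ∣                    ≡⟨ cong ∣_∣ x²≡3y² ⟩
    ∣ + 3 * (y * y) ∣            ≡⟨ ℤP.abs-* (+ 3) (y * y) ⟩
    3 ℕ.* ∣ y * y ∣              ≡⟨ cong (3 ℕ.*_) (ℤP.abs-* y y) ⟩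
    3 ℕ.* (∣ y ∣ ℕ.* ∣ y ∣)      ∎))
    where open ≡-Reasoning

  0≤x*x : ∀ x → 0ℤ ≤ x * x
  0≤x*x (+ n)    = subst (0ℤ ≤_) (ℤP.pos-* n n) (+≤+ ℕ.z≤n)
  0≤x*x -[1+ n ] = +≤+ ℕ.z≤n

  x*x≡0⇒x≡0 : ∀ x → x * x ≡ 0ℤ → x ≡ 0ℤ
  x*x≡0⇒x≡0 x x*x≡0 = [ id , id ]′ (ℤP.i*j≡0⇒i≡0∨j≡0 x x*x≡0)

  x²+y²+z²≡0⇒x≡0×y≡0×z≡0 : ∀ x y z → x * x + y * y + z * z ≡ 0ℤ →
                             x ≡ 0ℤ × y ≡ 0ℤ × z ≡ 0ℤ
  x²+y²+z²≡0⇒x≡0×y≡0×z≡0 = OrderedSquares.x²+y²+z²≡0⇒x≡0×y≡0×z≡0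
    ℤP.+-*-isCommutativeRing ℤP.≤-isPartialOrder ℤP.+-mono-≤ 0≤x*x x*x≡0⇒x≡0

module ℚ-Lemmas where
  open ℚ using (mkℚ; 0ℚ; 1ℚ; _+_; _*_; _≤_; toℚᵘ; ↥_; ↧_; ↧ₙ_)

  cross-multiply : ∀ x y → x * x ≡ (1ℚ + 1ℚ + 1ℚ) * (y * y) →
    (↥ x ℤ.* ↧ y) ℤ.* (↥ x ℤ.* ↧ y) ≡ ℤ.+ 3 ℤ.* ((↥ y ℤ.* ↧ x) ℤ.* (↥ y ℤ.* ↧ x))
  cross-multiply x@record{} y@record{} x²≡3y² with unnormalised
    where
    unnormalised : toℚᵘ x ℚᵘ.* toℚᵘ x ℚᵘ.≃ toℚᵘ (1ℚ + 1ℚ + 1ℚ) ℚᵘ.* (toℚᵘ y ℚᵘ.* toℚᵘ y)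
    unnormalised = begin
      toℚᵘ x ℚᵘ.* toℚᵘ x                               ≈⟨ ℚP.toℚᵘ-homo-* x x ⟨
      toℚᵘ (x * x)                                      ≈⟨ ℚP.toℚᵘ-cong x²≡3y² ⟩
      toℚᵘ ((1ℚ + 1ℚ + 1ℚ) * (y * y))                   ≈⟨ ℚP.toℚᵘ-homo-* (1ℚ + 1ℚ + 1ℚ) (y * y) ⟩
      toℚᵘ (1ℚ + 1ℚ + 1ℚ) ℚᵘ.* toℚᵘ (y * y)             ≈⟨ ℚᵘP.*-congˡ {toℚᵘ (1ℚ + 1ℚ + 1ℚ)} (ℚP.toℚᵘ-homo-* y y) ⟩
      toℚᵘ (1ℚ + 1ℚ + 1ℚ) ℚᵘ.* (toℚᵘ y ℚᵘ.* toℚᵘ y)    ∎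
      where open ℚᵘP.≃-Reasoning
  ... | ℚᵘ.*≡* cross-multiplied = begin
    (↥ x ℤ.* ↧ y) ℤ.* (↥ x ℤ.* ↧ y)                  ≡⟨ [ab]²≡a²b² (↥ x) (↧ y) ⟩
    (↥ x ℤ.* ↥ x) ℤ.* (↧ y ℤ.* ↧ y)                  ≡⟨ cong ((↥ x ℤ.* ↥ x) ℤ.*_) (↧-square y) ⟨
    (↥ x ℤ.* ↥ x) ℤ.* ℤ.+ (↧ₙ y ℕ.* ↧ₙ y)            ≡⟨ cong (λ n → (↥ x ℤ.* ↥ x) ℤ.* ℤ.+ n) (ℕP.*-identityˡ _) ⟨
    (↥ x ℤ.* ↥ x) ℤ.* ℤ.+ (1 ℕ.* (↧ₙ y ℕ.* ↧ₙ y))    ≡⟨ cross-multiplied ⟩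
    ℤ.+ 3 ℤ.* (↥ y ℤ.* ↥ y) ℤ.* ℤ.+ (↧ₙ x ℕ.* ↧ₙ x)  ≡⟨ cong (ℤ.+ 3 ℤ.* (↥ y ℤ.* ↥ y) ℤ.*_) (↧-square x) ⟩
    ℤ.+ 3 ℤ.* (↥ y ℤ.* ↥ y) ℤ.* (↧ x ℤ.* ↧ x)        ≡⟨ 3a²b²≡3[ab]² (↥ y) (↧ x) ⟩
    ℤ.+ 3 ℤ.* ((↥ y ℤ.* ↧ x) ℤ.* (↥ y ℤ.* ↧ x))      ∎
    where
    open ≡-Reasoning
    ↧-square : ∀ z → ℤ.+ (↧ₙ z ℕ.* ↧ₙ z) ≡ ↧ z ℤ.* ↧ z
    ↧-square z = ℤP.pos-* (↧ₙ z) (↧ₙ z)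
    [ab]²≡a²b² : ∀ a b → (a ℤ.* b) ℤ.* (a ℤ.* b) ≡ (a ℤ.* a) ℤ.* (b ℤ.* b)
    [ab]²≡a²b² = ℤ-Solver.solve-∀
    3a²b²≡3[ab]² : ∀ a b → ℤ.+ 3 ℤ.* (a ℤ.* a) ℤ.* (b ℤ.* b) ≡ ℤ.+ 3 ℤ.* ((a ℤ.* b) ℤ.* (a ℤ.* b))
    3a²b²≡3[ab]² = ℤ-Solver.solve-∀

  x²≡3y²⇒y≡0 : ∀ x y → x * x ≡ (1ℚ + 1ℚ + 1ℚ) * (y * y) → y ≡ 0ℚ
  x²≡3y²⇒y≡0 x@record{} y x²≡3y² = ℚP.↥p≡0⇒p≡0 y (ℤP.*-cancelʳ-≡ (↥ y) ℤ.0ℤ (↧ x) ↥y↧x≡0)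
    where
    ↥y↧x≡0 : ↥ y ℤ.* ↧ x ≡ ℤ.0ℤ
    ↥y↧x≡0 = ℤ-Lemmas.x²≡3y²⇒y≡0 (↥ x ℤ.* ↧ y) (↥ y ℤ.* ↧ x) (cross-multiply x y x²≡3y²)

  0≤x*x : ∀ x → 0ℚ ≤ x * x
  0≤x*x x@(mkℚ (ℤ.+ _) _ _)    = ℚP.nonNegative⁻¹ (x * x) {{ℚP.nonNeg*nonNeg⇒nonNeg x x}}
  0≤x*x x@(mkℚ ℤ.-[1+ _ ] _ _) =
    ℚP.nonNegative⁻¹ (x * x) {{ℚP.pos⇒nonNeg (x * x) {{ℚP.neg*neg⇒pos x x}}}}

  x*x≡0⇒x≡0 : ∀ x → x * x ≡ 0ℚ → x ≡ 0ℚ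
  x*x≡0⇒x≡0 x@(mkℚ (ℤ.+ 0) _ _)     _     = ℚP.↥p≡0⇒p≡0 x refl
  x*x≡0⇒x≡0 x@(mkℚ ℤ.+[1+ _ ] _ _) x*x≡0 =
    ⊥-elim (ℚP.<⇒≢ (ℚP.positive⁻¹ (x * x) {{ℚP.pos*pos⇒pos x x}}) (sym x*x≡0))
  x*x≡0⇒x≡0 x@(mkℚ ℤ.-[1+ _ ] _ _) x*x≡0 =
    ⊥-elim (ℚP.<⇒≢ (ℚP.positive⁻¹ (x * x) {{ℚP.neg*neg⇒pos x x}}) (sym x*x≡0))

  x²+y²+z²≡0⇒x≡0×y≡0×z≡0 : ∀ x y z → x * x + y * y + z * z ≡ 0ℚ →
                             x ≡ 0ℚ × y ≡ 0ℚ × z ≡ 0ℚ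
  x²+y²+z²≡0⇒x≡0×y≡0×z≡0 = OrderedSquares.x²+y²+z²≡0⇒x≡0×y≡0×z≡0
    ℚP.+-*-isCommutativeRing ℚP.≤-isPartialOrder ℚP.+-mono-≤ 0≤x*x x*x≡0⇒x≡0

theorem4p2 : Zs.NoEight × Zs.NoFour × Qs.NoEight × Qs.NoFour
theorem4p2 = ℤ-case.noEight , ℤ-case.noFour , ℚ-case.noEight , ℚ-case.noFour
  where
  module ℤ-case = CommutativeRingArgument.Nonexistence ℤP.+-*-isCommutativeRing
    ℤ-Lemmas.x²≡3y²⇒y≡0
    ℤ-Lemmas.x²+y²+z²≡0⇒x≡0×y≡0×z≡0
  module ℚ-case = CommutativeRingArgument.Nonexistence ℚP.+-*-isCommutativeRing
    ℚ-Lemmas.x²≡3y²⇒y≡0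
    ℚ-Lemmas.x²+y²+z²≡0⇒x≡0×y≡0×z≡0
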